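{- For every formula $A$ of $\mathscr{L}$, $\models_\Delta A\vee\neg A$; that is, for every (consistent) atomic base $\mathfrak{B}$ there is an argument $\langle\mathscr{D},\mathfrak{J}\rangle$ from $\emptyset$ to $A\vee\neg A$ valid on $\mathfrak{B}$.
   Context: The meta-language reasoning is classical. Language $\mathscr{L}$: formulas $X ::= p \mid \bot \mid X\wedge X \mid X \vee X \mid X \rightarrow X$ ($p$ propositional atoms; the $p$'s and $\bot$ are atoms); $\neg A := A\rightarrow\bot$. An atomic base $\mathfrak{B}$ is a countable set of production rules with atomic premises $A_1,\dots,A_n$ ($n\ge0$, $A_i\neq\bot$) and atomic conclusion; $\texttt{DER}_{\mathfrak{B}}$ is the set of its derivations, and bases are required to be consistent ($\bot$ is not derivable). An argument structure is a pair $\langle T,f\rangle$ where $T$ is a finite tree whose nodes are formulas of $\mathscr{L}$ or empty (empty nodes only as top-nodes), and $f$ is a function defined on a subset of the non-empty top-nodes assigning to each such node a node below it (discharge). Top-nodes are assumptions, the root is the conclusion; the structure is closed if all assumptions are discharged, else open; it is "from $\Gamma$ to $A$" if $\Gamma$ is its set of undischarged assumptions and $A$ its conclusion. For $\mathscr{D}$ from $\Gamma$ to $A$ and $\sigma$ assigning to each $B\in\Gamma$ a closed argument structure with conclusion $B$, $\mathscr{D}^\sigma$ is obtained by replacing each $B\in\Gamma$ by $\sigma(B)$. An inference is a triple $\langle\langle\mathscr{D}_1,\dots,\mathscr{D}_n\rangle, A,\delta\rangle$, $\delta$ indicating assumptions discharged; its associated argument structure joins the $\mathscr{D}_i$ under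 a new root $A$ with discharges extended by $\delta$. A rule is a set of inferences. The introduction rules are: from $A$ and $B$ infer $A\wedge B$; from $A_i$ infer $A_1\vee A_2$ ($i=1,2$); from $B$ infer $A\rightarrow B$ discharging $A$. An argument structure is canonical iff it is associated to an instance of an introduction rule. A justification of a rule $R$ is a constructive function $\phi$ defined on the argument structures associated to some subset of $R$ such that for each $\mathscr{D}$ in its domain: if $\mathscr{D}$ is from $\Gamma$ to $A$ then $\phi(\mathscr{D})$ is from some $\Gamma^*\subseteq\Gamma$ to $A$; and for every $\sigma$, $\phi$ is defined on $\mathscr{D}^\sigma$ and $\phi(\mathscr{D}^\sigma)=\phi(\mathscr{D})^\sigma$. For a set $\mathfrak{J}$ of justifications, $\mathscr{D}$ immediately reduces to $\mathscr{D}^*$ iff $\mathscr{D}=\mathscr{D}^*$ or, for some sub-structure $\mathscr{D}''$ of $\mathscr{D}$ and some $\phi\in\mathfrak{J}$ defined on $\mathscr{D}''$, $\mathscr{D}^*$ is $\mathscr{D}$ with $\mathscr{D}''$ replaced by $\phi(\mathscr{D}'')$; $\mathscr{D}\le^{\mathfrak{J}}\mathscr{D}^*$ iff there is a finite chain of immediate reductions from $\mathscr{D}$ to $\mathscr{D}^*$. An argument is a pair $\langle\mathscr{D},\mathfrak{J}\rangle$. It is valid on $\mathfrak{B}$ iff: (i) if $\mathscr{D}$ is closed with atomic conclusion, then $\mathscr{D}\le^{\mathfrak{J}}\langle T,\emptyset\rangle$ for some closed $T\in\texttt{DER}_{\mathfrak{B}}$; (ii) if $\mathscr{D}$ is closed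 with non-atomic conclusion, then $\mathscr{D}\le^{\mathfrak{J}}\mathscr{D}^*$ for some closed canonical $\mathscr{D}^*$ whose immediate sub-structures, paired with $\mathfrak{J}$, are valid on $\mathfrak{B}$; (iii) if $\mathscr{D}$ is open from $\Gamma$ to $A$, then for every $\sigma$ and every set of justifications $\mathfrak{J}^+\supseteq\mathfrak{J}$, if $\langle\sigma(B),\mathfrak{J}^+\rangle$ is valid on $\mathfrak{B}$ for the $B\in\Gamma$, then $\langle\mathscr{D}^\sigma,\mathfrak{J}^+\rangle$ is valid on $\mathfrak{B}$. Finally, $\Gamma\models_\Delta A$ iff for every base $\mathfrak{B}$ there is an argument $\langle\mathscr{D},\mathfrak{J}\rangle$ from $\Gamma$ to $A$ valid on $\mathfrak{B}$. -}

module Defs where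

open import Level using (Level; Lift; Setω) renaming (suc to lsuc; zero to lzero)
open import Data.Nat using (ℕ; _≡ᵇ_)
open import Data.Bool using (Bool; true; false; if_then_else_)
open import Data.List using (List; []; _∷_; _++_)
open import Data.List.Membership.Propositional using (_∈_)
open import Data.Product using (Σ; _×_; _,_)
open import Data.Sum using (_⊎_)
open import Relation.Nullary using (¬_)
open import Relation.Binary.PropositionalEquality using (_≡_)
open import Relation.Binary.Construct.Closure.ReflexiveTransitive using (Star)
open import Axiom.ExcludedMiddle using (ExcludedMiddle)

data Atom : Set where
  prop : ℕ → Atom
  ⊥ₐ   : Atom

infixr 6 _∧_
infixr 5 _∨_
infixr 4 _⇒_

data Formula : Set where
  atom : Atom → Formula
  _∧_  : Formula → Formula → Formula
  _∨_  : Formula → Formula → Formula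
  _⇒_  : Formula → Formula → Formula

⊥F : Formula
⊥F = atom ⊥ₐ

¬F : Formula → Formula
¬F A = A ⇒ ⊥F

-- a production rule: premises are propositional atoms (never ⊥),
-- the conclusion is any atom (possibly ⊥)
record Rule : Set where
  field
    premises   : List ℕ
    conclusion : Atom

-- a base is a set of rules (automatically countable: Rule is countable)
Base : Set₁
Base = Rule → Set

-- Discharge is represented by labels: an assumption leaf  hyp A k  is
-- discharged by the nearest node below it whose label list contains k;
-- otherwise it is undischarged.  Empty top-nodes are  emp ; inner nodes
-- have a non-empty list of children.

mutual
  data AS : Set where
    hyp  : Formula → ℕ → AS
    node : Formula → List ℕ → Kids → AS

  data Kid : Set where
    emp : Kid
    sub : AS → Kid

  data Kids : Set where
    one : Kid → Kids
    _◂_ : Kid → Kids → Kids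

infixr 5 _◂_

concl : AS → Formula
concl (hyp A _)    = A
concl (node A _ _) = A

elem : ℕ → List ℕ → Bool
elem k []       = false
elem k (x ∷ xs) = if k ≡ᵇ x then true else elem k xs

mutual
  ol : List ℕ → AS → List (Formula × ℕ)
  ol bs (hyp A k)      = if elem k bs then [] else (A , k) ∷ []
  ol bs (node A ds ks) = olKs (ds ++ bs) ks

  olK : List ℕ → Kid → List (Formula × ℕ)
  olK bs emp     = []
  olK bs (sub D) = ol bs D

  olKs : List ℕ → Kids → List (Formula × ℕ)
  olKs bs (one k)  = olK bs k
  olKs bs (k ◂ ks) = olK bs k ++ olKs bs ks

openLeaves : AS → List (Formula × ℕ)
openLeaves = ol []

Open : AS → Formula → Set
Open D B = Σ ℕ λ k → (B , k) ∈ openLeaves D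

Closed : AS → Set
Closed D = openLeaves D ≡ []

mutual
  sb : List ℕ → (Formula → AS) → AS → AS
  sb bs σ (hyp A k)      = if elem k bs then hyp A k else σ A
  sb bs σ (node A ds ks) = node A ds (sbKs (ds ++ bs) σ ks)

  sbK : List ℕ → (Formula → AS) → Kid → Kid
  sbK bs σ emp     = emp
  sbK bs σ (sub D) = sub (sb bs σ D)

  sbKs : List ℕ → (Formula → AS) → Kids → Kids
  sbKs bs σ (one k)  = one (sbK bs σ k)
  sbKs bs σ (k ◂ ks) = sbK bs σ k ◂ sbKs bs σ ks

_⟨_⟩ : AS → (Formula → AS) → AS
D ⟨ σ ⟩ = sb [] σ D

SubstFor : AS → (Formula → AS) → Set
SubstFor D σ = ∀ B → Open D B → Closed (σ B) × concl (σ B) ≡ B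

record Justification : Set₁ where
  field
    Dom     : AS → Set
    φ       : (D : AS) → Dom D → AS
    φ-irr   : ∀ D (d d′ : Dom D) → φ D d ≡ φ D d′
    φ-concl : ∀ D (d : Dom D) → concl (φ D d) ≡ concl D
    φ-open  : ∀ D (d : Dom D) B → Open (φ D d) B → Open D B
    φ-dom   : ∀ D σ → Dom D → SubstFor D σ → Dom (D ⟨ σ ⟩)
    φ-subst : ∀ D σ (d : Dom D) (s : SubstFor D σ) →
              φ (D ⟨ σ ⟩) (φ-dom D σ d s) ≡ (φ D d) ⟨ σ ⟩

JSet : Set₁
JSet = Justification → Set

_⊆J_ : JSet → JSet → Set₁
J ⊆J J′ = ∀ j → J j → J′ j

mutual
  data Repl (X Y : AS) : AS → AS → Set where
    here   : Repl X Y X Y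
    inside : ∀ {A ds ks ks′} → ReplKs X Y ks ks′ →
             Repl X Y (node A ds ks) (node A ds ks′)

  data ReplKs (X Y : AS) : Kids → Kids → Set where
    one : ∀ {D D′} → Repl X Y D D′ → ReplKs X Y (one (sub D)) (one (sub D′))
    hd  : ∀ {D D′ ks} → Repl X Y D D′ → ReplKs X Y (sub D ◂ ks) (sub D′ ◂ ks)
    tl  : ∀ {k ks ks′} → ReplKs X Y ks ks′ → ReplKs X Y (k ◂ ks) (k ◂ ks′)

Red1 : JSet → AS → AS → Set₁
Red1 J D D* =
  D ≡ D* ⊎
  Σ Justification λ j → J j × Σ AS λ X →
    Σ (Justification.Dom j X) λ d → Repl X (Justification.φ j X d) D D*

Reduces : JSet → AS → AS → Set₁
Reduces J = Star (Red1 J)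

mutual
  data Der (𝔅 : Base) : AS → Set where
    assm : ∀ a k → Der 𝔅 (hyp (atom a) k)
    rule : ∀ r → 𝔅 r → ∀ ks → DerKids 𝔅 (Rule.premises r) ks →
           Der 𝔅 (node (atom (Rule.conclusion r)) [] ks)

  data DerKids (𝔅 : Base) : List ℕ → Kids → Set where
    none : DerKids 𝔅 [] (one emp)
    last : ∀ {p D} → Der 𝔅 D → concl D ≡ atom (prop p) →
           DerKids 𝔅 (p ∷ []) (one (sub D))
    more : ∀ {p q qs D ks} → Der 𝔅 D → concl D ≡ atom (prop p) →
           DerKids 𝔅 (q ∷ qs) ks → DerKids 𝔅 (p ∷ q ∷ qs) (sub D ◂ ks)

Consistent : Base → Set
Consistent 𝔅 = ¬ (Σ AS λ T → Der 𝔅 T × Closed T × concl T ≡ ⊥F)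

-- VC 𝔅 A J D : the closed argument ⟨D,J⟩ with conclusion A is valid on 𝔅
-- (clauses (i),(ii)); recursion on A.  In the → clause the validity of the
-- immediate sub-structure (whose open assumptions are all A) is unfolded
-- by clauses (i)-(iii).

VC : Base → Formula → JSet → AS → Set₂
VC 𝔅 (atom a) J D =
  Lift (lsuc (lsuc lzero))
    (Σ AS λ T → Der 𝔅 T × Closed T × Reduces J D T)
VC 𝔅 (A ∧ B) J D =
  Σ AS λ D₁ → Σ AS λ D₂ → Σ (List ℕ) λ ds →
    Lift (lsuc (lsuc lzero))
      (Reduces J D (node (A ∧ B) ds (sub D₁ ◂ one (sub D₂))) ×
       concl D₁ ≡ A × concl D₂ ≡ B × Closed D₁ × Closed D₂) ×
    VC 𝔅 A J D₁ × VC 𝔅 B J D₂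
VC 𝔅 (A ∨ B) J D =
  Σ AS λ D₁ → Σ (List ℕ) λ ds →
    Lift (lsuc (lsuc lzero))
      (Reduces J D (node (A ∨ B) ds (one (sub D₁))) × Closed D₁) ×
    ((Lift (lsuc (lsuc lzero)) (concl D₁ ≡ A) × VC 𝔅 A J D₁) ⊎
     (Lift (lsuc (lsuc lzero)) (concl D₁ ≡ B) × VC 𝔅 B J D₁))
VC 𝔅 (A ⇒ B) J D =
  Σ AS λ D₁ → Σ (List ℕ) λ ds →
    Lift (lsuc (lsuc lzero))
      (Reduces J D (node (A ⇒ B) ds (one (sub D₁))) × concl D₁ ≡ B ×
       (∀ C k → (C , k) ∈ openLeaves D₁ → C ≡ A × k ∈ ds)) ×
    ((Closed D₁ → VC 𝔅 B J D₁) ×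
     (¬ Closed D₁ → ∀ σ (J′ : JSet) → J ⊆J J′ → SubstFor D₁ σ →
        (∀ C → Open D₁ C → VC 𝔅 A J′ (σ C)) → VC 𝔅 B J′ (D₁ ⟨ σ ⟩)))

Valid : Base → JSet → AS → Set₂
Valid 𝔅 J D =
  (Closed D → VC 𝔅 (concl D) J D) ×
  (¬ Closed D → ∀ σ (J′ : JSet) → J ⊆J J′ → SubstFor D σ →
     (∀ C → Open D C → VC 𝔅 C J′ (σ C)) → VC 𝔅 (concl D) J′ (D ⟨ σ ⟩))

ClassicalMeta : Setω
ClassicalMeta = ∀ {ℓ} → ExcludedMiddle ℓ

{-# OPTIONS --safe #-}
module Submission where

-- Classically, either A has a closed argument valid on 𝔅 (for some set of
-- justifications) or it has none.  In the first case ∨-introduction applied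
-- to it is a valid argument for A ∨ ¬A.  In the second case, derive ⊥ from the
-- assumption A by an inference nothing justifies and discharge A: clause (iii)
-- only asks for validity after substituting valid closed arguments for A, and
-- there are none, so this argument for ¬A is vacuously valid.

open import Defs
open import Data.Empty using (⊥; ⊥-elim)
open import Data.List using ([]; _∷_)
open import Data.List.Membership.Propositional using (_∈_)
open import Data.List.Relation.Unary.Any using (here; there)
open import Data.Product using (Σ; _×_; _,_; proj₁; proj₂)
open import Data.Sum using (inj₁; inj₂)
open import Level using (lift)
open import Relation.Binary.Construct.Closure.ReflexiveTransitive using (ε)
open import Relation.Binary.PropositionalEquality using (_≡_; refl)
open import Relation.Nullary using (¬_; yes; no; contradiction)

ClosedValidArgument : Base → Formula → Set₂
ClosedValidArgument 𝔅 A =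
  Σ AS λ D → Σ JSet λ J → Closed D × concl D ≡ A × VC 𝔅 A J D

closed⇒Valid : ∀ {𝔅 J} D → Closed D → VC 𝔅 (concl D) J D → Valid 𝔅 J D
closed⇒Valid _ closed valid = (λ _ → valid) , (λ open′ → contradiction closed open′)

VC-∨-introˡ : ∀ {𝔅 J A B ds D} → Closed D → concl D ≡ A → VC 𝔅 A J D →
              VC 𝔅 (A ∨ B) J (node (A ∨ B) ds (one (sub D)))
VC-∨-introˡ {ds = ds} {D} closed concl≡A valid =
  D , ds , lift (ε , closed) , inj₁ (lift concl≡A , valid)

VC-∨-introʳ : ∀ {𝔅 J A B ds D} → Closed D → concl D ≡ B → VC 𝔅 B J D →
              VC 𝔅 (A ∨ B) J (node (A ∨ B) ds (one (sub D)))
VC-∨-introʳ {ds = ds} {D} closed concl≡B valid =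
  D , ds , lift (ε , closed) , inj₂ (lift concl≡B , valid)

unjustified-⇒ : Formula → Formula → AS
unjustified-⇒ A B = node (A ⇒ B) (0 ∷ []) (one (sub (node B [] (one (sub (hyp A 0))))))

VC-unjustified-⇒ : ∀ {𝔅 J A B} → ¬ ClosedValidArgument 𝔅 A →
                   VC 𝔅 (A ⇒ B) J (unjustified-⇒ A B)
VC-unjustified-⇒ {𝔅} {J} {A} {B} noArgument =
  body , 0 ∷ [] , lift (ε , refl , onlyA) , (λ ()) , vacuous
  where
    body : AS
    body = node B [] (one (sub (hyp A 0)))

    onlyA : ∀ C k → (C , k) ∈ openLeaves body → C ≡ A × k ∈ 0 ∷ []
    onlyA C k (here refl) = refl , here refl
    onlyA C k (there ())

    openA : Open body A
    openA = 0 , here refl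

    vacuous : ¬ Closed body → ∀ σ J′ → J ⊆J J′ → SubstFor body σ →
              (∀ C → Open body C → VC 𝔅 A J′ (σ C)) → VC 𝔅 B J′ (body ⟨ σ ⟩)
    vacuous _ σ J′ _ σ-closed σ-valid = ⊥-elim (noArgument
      (σ A , J′ , proj₁ (σ-closed A openA) , proj₂ (σ-closed A openA) , σ-valid A openA))

proposition4 : ClassicalMeta → (A : Formula) (𝔅 : Base) → Consistent 𝔅 →
    Σ AS λ D → Σ JSet λ J → Closed D × concl D ≡ A ∨ ¬F A × Valid 𝔅 J D
proposition4 em A 𝔅 _ with em {P = ClosedValidArgument 𝔅 A}
... | yes (D , J , closed , concl≡A , valid) =
  A∨¬A , J , closed , refl , closed⇒Valid A∨¬A closed (VC-∨-introˡ closed concl≡A valid)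
  where
    A∨¬A : AS
    A∨¬A = node (A ∨ ¬F A) [] (one (sub D))
... | no noArgument =
  A∨¬A , (λ _ → ⊥) , refl , refl ,
  closed⇒Valid A∨¬A refl (VC-∨-introʳ refl refl (VC-unjustified-⇒ noArgument))
  where
    A∨¬A : AS
    A∨¬A = node (A ∨ ¬F A) [] (one (sub (unjustified-⇒ A ⊥F)))
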